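{- Let $n$ be a positive integer and let $d$ be a positive divisor of $n$ with $\gcd(d,n/d)=1$. Then $K_d\otimes K_{n/d}\simeq \mathrm{ICG}_n\big(\{d_1d_2 \mid d_1\in D_d,\ d_2\in D_{n/d}\}\big)$.
   Context: $K_r$ is the complete graph on $r$ vertices. The tensor product $G\otimes H$ has vertex set $V(G)\times V(H)$, with $(u,u')$ adjacent to $(v,v')$ iff $u\sim v$ in $G$ and $u'\sim v'$ in $H$. For a positive integer $m$, $D_m$ denotes the set of positive divisors of $m$ other than $m$ itself. For $D\subseteq D_n$, the integral circulant graph $\mathrm{ICG}_n(D)$ is the graph on $\mathbb{Z}_n=\{0,\ldots,n-1\}$ in which $i$ and $j$ are adjacent iff $\gcd(i-j,n)\in D$ (equivalently, the circulant graph with symbol $\bigcup_{\delta\in D}\{k: 1\le k\le n-1,\ \gcd(k,n)=\delta\}$). -}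

module Defs where

open import Level using (0ℓ)
open import Data.Nat using (ℕ; _∸_; _*_; _≤_; _≤?_)
open import Data.Nat.Divisibility using (_∣_)
open import Data.Nat.GCD using (gcd)
open import Data.Fin using (Fin; toℕ)
open import Data.Product using (_×_; _,_; Σ; ∃; ∃-syntax)
open import Relation.Nullary using (¬_; yes; no)
open import Relation.Binary.PropositionalEquality using (_≡_; _≢_)
open import Function.Bundles using (_⤖_; Bijection)

record Graph : Set₁ where
  field
    V   : Set
    Adj : V → V → Set
open Graph public

K : ℕ → Graph
K r = record { V = Fin r ; Adj = λ i j → i ≢ j }

_⊗_ : Graph → Graph → Graph
G ⊗ H = record
  { V   = V G × V H
  ; Adj = λ { (u , u′) (v , v′) → Adj G u v × Adj H u′ v′ } }

-- D_m : positive divisors of m other than m itself.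
ProperDivisor : ℕ → ℕ → Set
ProperDivisor m δ = (δ ∣ m) × (δ ≢ m)

absDiff : ℕ → ℕ → ℕ
absDiff a b with a ≤? b
... | yes _ = b ∸ a
... | no  _ = a ∸ b

-- Integral circulant graph ICG_n(D), D given as a predicate on ℕ.
-- i ~ j iff gcd(i - j, n) ∈ D (gcd(i-j mod n, n) = gcd(|i-j|, n)).
ICG : (n : ℕ) → (ℕ → Set) → Graph
ICG n D = record
  { V   = Fin n
  ; Adj = λ i j → D (gcd (absDiff (toℕ i) (toℕ j)) n) }

_≅_ : Graph → Graph → Set
G ≅ H = Σ (V G ⤖ V H) λ f →
  ∀ u v → (Adj G u v → Adj H (Bijection.to f u) (Bijection.to f v))
        × (Adj H (Bijection.to f u) (Bijection.to f v) → Adj G u v)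

ProdDivSet : ℕ → ℕ → ℕ → Set
ProdDivSet d m δ = ∃[ d₁ ] ∃[ d₂ ] ProperDivisor d d₁ × ProperDivisor m d₂ × (δ ≡ d₁ * d₂)

-- By the Chinese remainder theorem x ↦ (x mod d, x mod m) identifies ℤ_n with ℤ_d × ℤ_m,
-- and two residues differ in both coordinates iff d ∤ i − j and m ∤ i − j. For coprime d, m
-- the gcd splits as gcd(k, dm) = gcd(k, d) · gcd(k, m), so this happens iff gcd(i − j, n)
-- is a product of a proper divisor of d and a proper divisor of m.
module Submission where

open import Defs
open import Data.Nat using (ℕ; zero; suc; _+_; _*_; _≥_; _∸_; _≤_; _<_; _≤?_; NonZero; >-nonZero; ∣_-_∣)
open import Data.Nat.Properties
  using (≤-total; ≰⇒≥; <⇒≱; ≤-<-trans; 1+n≰n; *-comm; *-identityˡ; *-distribʳ-∸; m+[n∸m]≡n; [m+n]∸[m+o]≡n∸o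
        ; ∣-∣-comm; m≤n⇒∣m-n∣≡n∸m; ∣m-n∣≡0⇒m≡n; ∣m-n∣≤m⊔n; ⊔-pres-<m; m*n≢0⇒m≢0; m*n≢0⇒n≢0)
open import Data.Nat.DivMod using (_%_; _/_; _mod_; m%n<n; m≡m%n+[m/n]*n; [m+kn]%n≡m%n)
open import Data.Nat.Divisibility using (_∣_; divides; ∣⇒≤; ∣-refl; ∣-trans; ∣-antisym; m∣m*n; n∣m*n)
open import Data.Nat.GCD using (gcd; gcd[m,n]∣m; gcd[m,n]∣n; gcd-greatest; c*gcd[m,n]≡gcd[cm,cn])
open import Data.Nat.LCM using (lcm; lcm-least; gcd*lcm)
open import Data.Nat.Coprimality as Coprime using (Coprime; coprime-divisor; coprime⇒gcd≡1; gcd≡1⇒coprime)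
open import Data.Fin using (Fin; toℕ; combine; punchOut)
open import Data.Fin.Properties using (toℕ-fromℕ<; fromℕ<-cong; toℕ-injective; toℕ<n; combine-injective; punchOut-injective; injective⇒≤; any?; _≟_)
open import Data.Product using (_×_; _,_; proj₁; proj₂)
open import Data.Product.Properties using (×-≡,≡→≡)
open import Data.Sum using (inj₁; inj₂)
open import Function using (_∘_; _$_)
open import Function.Bundles using (_⤖_; _⇔_; mk⇔; mk↔ₛ′; Equivalence)
open import Function.Definitions using (Injective; StrictlySurjective)
open import Function.Properties.Inverse using (↔⇒⤖)
open import Relation.Nullary using (¬_; yes; no; contradiction)
open import Relation.Binary.PropositionalEquality using (_≡_; _≢_; refl; sym; trans; cong; cong₂; subst; subst₂; module ≡-Reasoning)

open Equivalence using (to; from)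

absDiff≡∣-∣ : ∀ x y → absDiff x y ≡ ∣ x - y ∣
absDiff≡∣-∣ x y with x ≤? y
... | yes x≤y = sym (m≤n⇒∣m-n∣≡n∸m x≤y)
... | no  x≰y = sym (trans (∣-∣-comm x y) (m≤n⇒∣m-n∣≡n∸m (≰⇒≥ x≰y)))

%≡%⇒∣∸ : ∀ x y d .{{_ : NonZero d}} → x % d ≡ y % d → d ∣ y ∸ x
%≡%⇒∣∸ x y d x%d≡y%d = divides (y / d ∸ x / d) $ begin
  y ∸ x                                       ≡⟨ cong₂ _∸_ (m≡m%n+[m/n]*n y d) (m≡m%n+[m/n]*n x d) ⟩
  (y % d + y / d * d) ∸ (x % d + x / d * d)   ≡⟨ cong (λ r → (y % d + y / d * d) ∸ (r + x / d * d)) x%d≡y%d ⟩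
  (y % d + y / d * d) ∸ (y % d + x / d * d)   ≡⟨ [m+n]∸[m+o]≡n∸o (y % d) _ _ ⟩
  y / d * d ∸ x / d * d                       ≡⟨ *-distribʳ-∸ d (y / d) (x / d) ⟨
  (y / d ∸ x / d) * d                         ∎
  where open ≡-Reasoning

∣∸⇒%≡% : ∀ {x y} d .{{_ : NonZero d}} → x ≤ y → d ∣ y ∸ x → x % d ≡ y % d
∣∸⇒%≡% {x} {y} d x≤y (divides q y∸x≡q*d) = begin
  x % d              ≡⟨ [m+kn]%n≡m%n x q d ⟨
  (x + q * d) % d    ≡⟨ cong (λ t → (x + t) % d) y∸x≡q*d ⟨
  (x + (y ∸ x)) % d  ≡⟨ cong (_% d) (m+[n∸m]≡n x≤y) ⟩
  y % d              ∎
  where open ≡-Reasoning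

≤⇒[%≡%⇔∣∣-∣] : ∀ {x y} d .{{_ : NonZero d}} → x ≤ y → x % d ≡ y % d ⇔ d ∣ ∣ x - y ∣
≤⇒[%≡%⇔∣∣-∣] {x} {y} d x≤y = mk⇔
  (subst (d ∣_) (sym (m≤n⇒∣m-n∣≡n∸m x≤y)) ∘ %≡%⇒∣∸ x y d)
  (∣∸⇒%≡% d x≤y ∘ subst (d ∣_) (m≤n⇒∣m-n∣≡n∸m x≤y))

%≡%⇔∣∣-∣ : ∀ x y d .{{_ : NonZero d}} → x % d ≡ y % d ⇔ d ∣ ∣ x - y ∣
%≡%⇔∣∣-∣ x y d with ≤-total x y
... | inj₁ x≤y = ≤⇒[%≡%⇔∣∣-∣] d x≤y
... | inj₂ y≤x = mk⇔
  (subst (d ∣_) (∣-∣-comm y x) ∘ to (≤⇒[%≡%⇔∣∣-∣] d y≤x) ∘ sym)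
  (sym ∘ from (≤⇒[%≡%⇔∣∣-∣] d y≤x) ∘ subst (d ∣_) (∣-∣-comm x y))

mod≡mod⇔∣absDiff : ∀ x y d .{{_ : NonZero d}} → x mod d ≡ y mod d ⇔ d ∣ absDiff x y
mod≡mod⇔∣absDiff x y d = mk⇔
  (subst (d ∣_) (sym (absDiff≡∣-∣ x y)) ∘ to (%≡%⇔∣∣-∣ x y d) ∘ mod≡⇒%≡)
  (%≡⇒mod≡ ∘ from (%≡%⇔∣∣-∣ x y d) ∘ subst (d ∣_) (absDiff≡∣-∣ x y))
  where
  mod≡⇒%≡ : x mod d ≡ y mod d → x % d ≡ y % d
  mod≡⇒%≡ eq = trans (sym (toℕ-fromℕ< (m%n<n x d))) (trans (cong toℕ eq) (toℕ-fromℕ< (m%n<n y d)))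
  %≡⇒mod≡ : x % d ≡ y % d → x mod d ≡ y mod d
  %≡⇒mod≡ eq = fromℕ<-cong _ _ eq (m%n<n x d) (m%n<n y d)

∣∧<⇒≡0 : ∀ {m n} → m ∣ n → n < m → n ≡ 0
∣∧<⇒≡0 {n = zero}  _   _   = refl
∣∧<⇒≡0 {n = suc _} m∣n n<m = contradiction (∣⇒≤ m∣n) (<⇒≱ n<m)

coprime-∣ : ∀ {m n i j} → Coprime m n → i ∣ m → j ∣ n → Coprime i j
coprime-∣ cop i∣m j∣n (k∣i , k∣j) = cop (∣-trans k∣i i∣m , ∣-trans k∣j j∣n)

coprime⇒*∣ : ∀ {m n c} → Coprime m n → m ∣ c → n ∣ c → m * n ∣ c
coprime⇒*∣ {m} {n} cop m∣c n∣c = subst (_∣ _) lcm≡m*n (lcm-least m∣c n∣c)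
  where
  lcm≡m*n : lcm m n ≡ m * n
  lcm≡m*n = trans (sym (*-identityˡ (lcm m n)))
                  (trans (cong (_* lcm m n) (sym (coprime⇒gcd≡1 cop))) (gcd*lcm m n))

-- n·gcd(k,m) = gcd(nk, nm) and gcd(k,m)·gcd(k,n) = gcd(gcd(k,m)·k, gcd(k,m)·n).
gcd[k,m*n]∣gcd[k,m]*gcd[k,n] : ∀ k m n → gcd k (m * n) ∣ gcd k m * gcd k n
gcd[k,m*n]∣gcd[k,m]*gcd[k,n] k m n =
  subst (g ∣_) (sym (c*gcd[m,n]≡gcd[cm,cn] (gcd k m) k n))
    (gcd-greatest (∣-trans g∣k (n∣m*n (gcd k m))) (subst (g ∣_) (*-comm n (gcd k m)) g∣n*gcd[k,m]))
  where
  g = gcd k (m * n)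
  g∣k = gcd[m,n]∣m k (m * n)
  g∣n*gcd[k,m] : g ∣ n * gcd k m
  g∣n*gcd[k,m] = subst (g ∣_) (sym (c*gcd[m,n]≡gcd[cm,cn] n k m))
    (gcd-greatest (∣-trans g∣k (n∣m*n n)) (subst (g ∣_) (*-comm m n) (gcd[m,n]∣n k (m * n))))

gcd-split : ∀ {m n} k → Coprime m n → gcd k (m * n) ≡ gcd k m * gcd k n
gcd-split {m} {n} k cop = ∣-antisym
  (gcd[k,m*n]∣gcd[k,m]*gcd[k,n] k m n)
  (coprime⇒*∣ (coprime-∣ cop (gcd[m,n]∣n k m) (gcd[m,n]∣n k n))
    (gcd-greatest (gcd[m,n]∣m k m) (∣-trans (gcd[m,n]∣n k m) (m∣m*n n)))
    (gcd-greatest (gcd[m,n]∣m k n) (∣-trans (gcd[m,n]∣n k n) (n∣m*n m))))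

gcd-properDivisor : ∀ {d k} → ¬ d ∣ k → ProperDivisor d (gcd k d)
gcd-properDivisor {d} {k} d∤k = gcd[m,n]∣n k d , λ gcd≡d → d∤k (subst (_∣ k) gcd≡d (gcd[m,n]∣m k d))

properDivisor*∤ : ∀ {d m d₁ d₂} → Coprime d m → ProperDivisor d d₁ → d₂ ∣ m → ¬ d ∣ d₁ * d₂
properDivisor*∤ {d} {d₁ = d₁} {d₂} cop (d₁∣d , d₁≢d) d₂∣m d∣d₁*d₂ =
  d₁≢d (∣-antisym d₁∣d (coprime-divisor (coprime-∣ cop ∣-refl d₂∣m) (subst (d ∣_) (*-comm d₁ d₂) d∣d₁*d₂)))

gcd∈ProdDivSet⇔ : ∀ {d m} k → Coprime d m → ProdDivSet d m (gcd k (d * m)) ⇔ (¬ d ∣ k × ¬ m ∣ k)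
gcd∈ProdDivSet⇔ {d} {m} k cop = mk⇔ necessary sufficient
  where
  necessary : ProdDivSet d m (gcd k (d * m)) → ¬ d ∣ k × ¬ m ∣ k
  necessary (d₁ , d₂ , pd₁ , (d₂∣m , d₂≢m) , g≡d₁*d₂) =
      (λ d∣k → properDivisor*∤ cop pd₁ d₂∣m
                 (subst (d ∣_) g≡d₁*d₂ (gcd-greatest d∣k (m∣m*n m))))
    , (λ m∣k → properDivisor*∤ (Coprime.sym cop) (d₂∣m , d₂≢m) (proj₁ pd₁)
                 (subst (m ∣_) (trans g≡d₁*d₂ (*-comm d₁ d₂)) (gcd-greatest m∣k (n∣m*n d))))
  sufficient : ¬ d ∣ k × ¬ m ∣ k → ProdDivSet d m (gcd k (d * m))
  sufficient (d∤k , m∤k) =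
    gcd k d , gcd k m , gcd-properDivisor d∤k , gcd-properDivisor m∤k , gcd-split k cop

-- Pigeonhole: a point missed by an injective f would let punchOut squeeze Fin (suc n) into Fin n.
injective⇒strictlySurjective : ∀ {n} {f : Fin n → Fin n} → Injective _≡_ _≡_ f → StrictlySurjective _≡_ f
injective⇒strictlySurjective {suc n} {f} f-injective y with any? (λ x → f x ≟ y)
... | yes hit = hit
... | no  miss = contradiction (injective⇒≤ squeeze-injective) 1+n≰n
  where
  y≢f : ∀ x → y ≢ f x
  y≢f x y≡fx = miss (x , sym y≡fx)
  squeeze-injective : Injective _≡_ _≡_ (λ x → punchOut (y≢f x))
  squeeze-injective = f-injective ∘ punchOut-injective (y≢f _) (y≢f _)

module ChineseRemainder {d m : ℕ} .{{_ : NonZero d}} .{{_ : NonZero m}} (coprime : Coprime d m) where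

  residues : Fin (d * m) → Fin d × Fin m
  residues x = toℕ x mod d , toℕ x mod m

  residues-injective : Injective _≡_ _≡_ residues
  residues-injective {x} {y} eq = toℕ-injective (∣m-n∣≡0⇒m≡n ∣x-y∣≡0)
    where
    X = toℕ x
    Y = toℕ y
    dm∣∣x-y∣ : d * m ∣ ∣ X - Y ∣
    dm∣∣x-y∣ = subst (d * m ∣_) (absDiff≡∣-∣ X Y) $ coprime⇒*∣ coprime
      (to (mod≡mod⇔∣absDiff X Y d) (cong proj₁ eq))
      (to (mod≡mod⇔∣absDiff X Y m) (cong proj₂ eq))
    ∣x-y∣≡0 : ∣ X - Y ∣ ≡ 0
    ∣x-y∣≡0 = ∣∧<⇒≡0 dm∣∣x-y∣ (≤-<-trans (∣m-n∣≤m⊔n X Y) (⊔-pres-<m (toℕ<n x) (toℕ<n y)))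

  combine∘residues-injective : Injective _≡_ _≡_ (λ x → combine (proj₁ (residues x)) (proj₂ (residues x)))
  combine∘residues-injective = residues-injective ∘ ×-≡,≡→≡ ∘ combine-injective _ _ _ _

  residues-surjective : StrictlySurjective _≡_ residues
  residues-surjective (i , j) with injective⇒strictlySurjective combine∘residues-injective (combine i j)
  ... | x , eq = x , ×-≡,≡→≡ (combine-injective _ _ i j eq)

  crt : Fin d × Fin m → Fin (d * m)
  crt u = proj₁ (residues-surjective u)

  residues-crt : ∀ u → residues (crt u) ≡ u
  residues-crt u = proj₂ (residues-surjective u)

  crt-residues : ∀ x → crt (residues x) ≡ x
  crt-residues x = residues-injective (residues-crt (residues x))

  crt-⤖ : (Fin d × Fin m) ⤖ Fin (d * m)
  crt-⤖ = ↔⇒⤖ (mk↔ₛ′ crt residues crt-residues residues-crt)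

  residues-adjacent⇔ : ∀ x y →
    Adj (K d ⊗ K m) (residues x) (residues y) ⇔ Adj (ICG (d * m) (ProdDivSet d m)) x y
  residues-adjacent⇔ x y = mk⇔
    (λ (≢d , ≢m) → from (gcd∈ProdDivSet⇔ k coprime)
                     (≢d ∘ from (mod≡mod⇔∣absDiff X Y d) , ≢m ∘ from (mod≡mod⇔∣absDiff X Y m)))
    (λ adj → let (d∤k , m∤k) = to (gcd∈ProdDivSet⇔ k coprime) adj
             in d∤k ∘ to (mod≡mod⇔∣absDiff X Y d) , m∤k ∘ to (mod≡mod⇔∣absDiff X Y m))
    where
    X = toℕ x
    Y = toℕ y
    k = absDiff X Y

  K⊗K≅ICG : (K d ⊗ K m) ≅ ICG (d * m) (ProdDivSet d m)
  K⊗K≅ICG = crt-⤖ , λ u v →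
      to (residues-adjacent⇔ (crt u) (crt v)) ∘ subst₂ (Adj (K d ⊗ K m)) (sym (residues-crt u)) (sym (residues-crt v))
    , subst₂ (Adj (K d ⊗ K m)) (residues-crt u) (residues-crt v) ∘ from (residues-adjacent⇔ (crt u) (crt v))

open ChineseRemainder using (K⊗K≅ICG)

theorem4p3 : (n d m : ℕ) → n ≥ 1 → n ≡ d * m → gcd d m ≡ 1 →
    (K d ⊗ K m) ≅ ICG n (ProdDivSet d m)
theorem4p3 .(d * m) d m d*m≥1 refl gcd[d,m]≡1 =
  K⊗K≅ICG {{m*n≢0⇒m≢0 d}} {{m*n≢0⇒n≢0 d}} (gcd≡1⇒coprime gcd[d,m]≡1)
  where
  instance
    d*m≢0 : NonZero (d * m)
    d*m≢0 = >-nonZero d*m≥1
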